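{- Let $G$ be a partial cube with weights $a,b:V(G)\to\mathbb{R}^+$, and let $E_1,\ldots,E_k$ be the $\Theta$-classes of $G$. For each $i$, let $C_i^1,C_i^2$ be the two connected components of $G\setminus E_i$, and put $A_j(E_i)=\sum_{x\in V(C_i^j)}a(x)$ and $B_j(E_i)=\sum_{x\in V(C_i^j)}b(x)$ for $j\in\{1,2\}$. Then $$W(G,a,b)=\sum_{i=1}^k\left(A_1(E_i)B_2(E_i)+A_2(E_i)B_1(E_i)\right).$$
   Context: A partial cube is a graph admitting an isometric embedding into a hypercube (a Cartesian product of copies of $K_2$). Two edges $u_1v_1$, $u_2v_2$ are in relation $\Theta$ if $d(u_1,u_2)+d(v_1,v_2)\neq d(u_1,v_2)+d(v_1,u_2)$; in a partial cube $\Theta$ is an equivalence relation, and for each $\Theta$-class $E$ the graph $G\setminus E$ has exactly two connected components. $W(G,a,b)=\sum_{\{u,v\}\subseteq V(G)}(a(u)b(v)+a(v)b(u))\,d_G(u,v)$, sum over unordered pairs of distinct vertices.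
   Formalization: The vertex weights a and b take values in the positive rationals instead of ℝ⁺. -}

module Defs where

open import Data.Nat using (ℕ; zero; suc; _≤_; _<_)
import Data.Nat as ℕ
open import Data.Bool using (Bool; true; false; if_then_else_)
open import Data.Fin using (Fin; zero; suc; toℕ)
open import Data.Integer using (+_)
open import Data.Rational using (ℚ; 0ℚ; _+_; _*_; _/_; _<_)
open import Data.Product using (Σ; ∃; ∃-syntax; _×_; _,_)
open import Data.Unit using (⊤)
open import Relation.Nullary using (¬_)
open import Relation.Binary.PropositionalEquality using (_≡_; _≢_)
open import Relation.Nullary.Decidable using (⌊_⌋)
open import Function.Bundles using (_⇔_)

record Graph (n : ℕ) : Set₁ where
  field
    Adj    : Fin n → Fin n → Set
    sym    : ∀ {u v} → Adj u v → Adj v u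
    irrefl : ∀ {u} → ¬ Adj u u
open Graph public

data Walk {n : ℕ} (G : Graph n) (Allowed : (u v : Fin n) → Adj G u v → Set)
          : Fin n → Fin n → ℕ → Set where
  nil  : ∀ {u} → Walk G Allowed u u 0
  cons : ∀ {u w v k} (p : Adj G u w) → Allowed u w p →
         Walk G Allowed w v k → Walk G Allowed u v (suc k)

AllEdges : ∀ {n} (G : Graph n) → (u v : Fin n) → Adj G u v → Set
AllEdges G _ _ _ = ⊤

-- d is the shortest-path distance of G (in particular G is connected).
IsDistance : ∀ {n} (G : Graph n) → (Fin n → Fin n → ℕ) → Set
IsDistance G d =
  (∀ u v → Walk G (AllEdges G) u v (d u v)) ×
  (∀ u v k → Walk G (AllEdges G) u v k → d u v ≤ k)

-- Hamming distance = distance in the hypercube Q_m = K_2^m.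
hamming : ∀ {m} → (Fin m → Bool) → (Fin m → Bool) → ℕ
hamming {zero}  x y = 0
hamming {suc m} x y =
  (if ⌊ x zero Data.Bool.≟ y zero ⌋ then 0 else 1)
    ℕ.+ hamming {m} (λ i → x (suc i)) (λ i → y (suc i))

IsPartialCube : ∀ {n} (G : Graph n) → (Fin n → Fin n → ℕ) → Set
IsPartialCube {n} G d =
  ∃[ m ] Σ (Fin n → (Fin m → Bool)) λ f → ∀ u v → hamming (f u) (f v) ≡ d u v

Θ : ∀ {n} → (Fin n → Fin n → ℕ) → (u₁ v₁ u₂ v₂ : Fin n) → Set
Θ d u₁ v₁ u₂ v₂ = d u₁ u₂ ℕ.+ d v₁ v₂ ≢ d u₁ v₂ ℕ.+ d v₁ u₂

ΣF : ∀ {n} → (Fin n → ℚ) → ℚ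
ΣF {zero}  f = 0ℚ
ΣF {suc n} f = f zero + ΣF (λ i → f (suc i))

ℕ→ℚ : ℕ → ℚ
ℕ→ℚ k = + k / 1

W : ∀ {n} → (Fin n → Fin n → ℕ) → (Fin n → ℚ) → (Fin n → ℚ) → ℚ
W d a b = ΣF λ u → ΣF λ v →
  if ⌊ toℕ u Data.Nat.<? toℕ v ⌋
  then (a u * b v + a v * b u) * ℕ→ℚ (d u v)
  else 0ℚ

ΣSide : ∀ {n} → (Fin n → Bool) → Bool → (Fin n → ℚ) → ℚ
ΣSide side s w = ΣF λ x → if ⌊ side x Data.Bool.≟ s ⌋ then w x else 0ℚ

Connected : ∀ {n} (G : Graph n) → ((u v : Fin n) → Adj G u v → Set) → Fin n → Fin n → Set
Connected G Allowed u v = ∃[ k ] Walk G Allowed u v k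

{-# OPTIONS --safe #-}
-- The distance d(u,v) is the number of Θ-classes separating u and v. Along a geodesic
-- u u′ … v, the class E of the first edge uu′ separates u from v, since a walk avoiding E
-- keeps d(w,u′) = d(w,u) + 1, which fails at w = v; it does not separate u′ from v, since
-- each edge of the geodesic moves away from u and u′ alike and so is not Θ-related to uu′;
-- and every other class leaves u and u′ together. Substituting this count into W and
-- exchanging the sums, E_i contributes the sum of a(u) b(v) over ordered pairs (u, v) on
-- opposite sides of E_i, which factors as A₁B₂ + A₂B₁.
module Submission where

open import Defs hiding (sym)
open import Data.Nat using (ℕ; zero; suc; _≤_)
import Data.Nat as ℕ
import Data.Nat.Properties as ℕ
import Data.Nat.Coprimality as Coprime
import Data.Integer as ℤ
import Data.Integer.Properties as ℤ
open import Data.Bool using (Bool; true; false; if_then_else_)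
import Data.Bool as Bool
open import Data.Fin using (Fin; zero; suc; toℕ)
import Data.Fin.Properties as Fin
open import Data.Rational using (ℚ; mkℚ; 0ℚ; 1ℚ; _+_; _*_; _/_; _<_)
open import Data.Rational.Properties
  using ( +-assoc; +-identityˡ; +-identityʳ; *-zeroˡ; *-zeroʳ; *-distribˡ-+; *-distribʳ-+
        ; +-0-commutativeMonoid; normalize-coprime)
open import Algebra.Bundles using (CommutativeMonoid)
open import Algebra.Properties.CommutativeSemigroup
  (CommutativeMonoid.commutativeSemigroup +-0-commutativeMonoid) using (interchange; x∙yz≈y∙xz)
open import Data.Rational.Solver using (module +-*-Solver)
open +-*-Solver using (solve; con; _:+_; _:*_; _:=_)
open import Data.Product using (Σ; ∃-syntax; _×_; _,_; proj₁; proj₂)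
open import Data.Unit using (tt)
open import Data.Empty using (⊥-elim)
open import Relation.Nullary using (yes; no)
open import Relation.Nullary.Decidable using (⌊_⌋; decidable-stable)
open import Relation.Binary.PropositionalEquality
  using (_≡_; _≢_; refl; sym; trans; cong; cong₂; subst; module ≡-Reasoning)
open import Function using (_∘_)
open import Function.Bundles using (_⇔_; Equivalence)

ΣF-cong : ∀ {n} {f g : Fin n → ℚ} → (∀ i → f i ≡ g i) → ΣF f ≡ ΣF g
ΣF-cong {zero}  f≗g = refl
ΣF-cong {suc n} f≗g = cong₂ _+_ (f≗g zero) (ΣF-cong (λ i → f≗g (suc i)))

ΣF-zero : ∀ {n} {f : Fin n → ℚ} → (∀ i → f i ≡ 0ℚ) → ΣF f ≡ 0ℚ
ΣF-zero {zero}  f≗0 = refl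
ΣF-zero {suc n} f≗0 = trans (cong₂ _+_ (f≗0 zero) (ΣF-zero (λ i → f≗0 (suc i)))) (+-identityʳ 0ℚ)

ΣF-+ : ∀ {n} (f g : Fin n → ℚ) → ΣF (λ i → f i + g i) ≡ ΣF f + ΣF g
ΣF-+ {zero}  f g = sym (+-identityʳ 0ℚ)
ΣF-+ {suc n} f g = trans (cong (f zero + g zero +_) (ΣF-+ (λ i → f (suc i)) (λ i → g (suc i))))
  (interchange (f zero) (g zero) _ _)

ΣF-*ˡ : ∀ {n} (c : ℚ) (f : Fin n → ℚ) → ΣF (λ i → c * f i) ≡ c * ΣF f
ΣF-*ˡ {zero}  c f = sym (*-zeroʳ c)
ΣF-*ˡ {suc n} c f = trans (cong (c * f zero +_) (ΣF-*ˡ c (λ i → f (suc i))))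
  (sym (*-distribˡ-+ c (f zero) _))

ΣF-*ʳ : ∀ {n} (c : ℚ) (f : Fin n → ℚ) → ΣF (λ i → f i * c) ≡ ΣF f * c
ΣF-*ʳ {zero}  c f = sym (*-zeroˡ c)
ΣF-*ʳ {suc n} c f = trans (cong (f zero * c +_) (ΣF-*ʳ c (λ i → f (suc i))))
  (sym (*-distribʳ-+ c (f zero) _))

ΣF-swap : ∀ {n m} (f : Fin n → Fin m → ℚ) →
          ΣF (λ i → ΣF (λ j → f i j)) ≡ ΣF (λ j → ΣF (λ i → f i j))
ΣF-swap {zero} {m} f = sym (ΣF-zero {m} (λ _ → refl))
ΣF-swap {suc n} f = trans (cong (ΣF (f zero) +_) (ΣF-swap (λ i → f (suc i))))
  (sym (ΣF-+ (f zero) (λ j → ΣF (λ i → f (suc i) j))))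

ΣF-differAt : ∀ {n} {f g : Fin n → ℚ} (j : Fin n) (c : ℚ) →
              (∀ i → i ≢ j → f i ≡ g i) → f j ≡ c + g j → ΣF f ≡ c + ΣF g
ΣF-differAt zero    c f≗g fj = trans (cong₂ _+_ fj (ΣF-cong (λ i → f≗g (suc i) (λ ())))) (+-assoc c _ _)
ΣF-differAt {g = g} (suc j) c f≗g fj =
  trans (cong₂ _+_ (f≗g zero (λ ())) (ΣF-differAt j c (λ i i≢j → f≗g (suc i) (i≢j ∘ Fin.suc-injective)) fj))
        (x∙yz≈y∙xz (g zero) c _)

ΣF² : ∀ {n} → (Fin n → Fin n → ℚ) → ℚ
ΣF² f = ΣF (λ u → ΣF (f u))

ΣF²-cong : ∀ {n} {f g : Fin n → Fin n → ℚ} → (∀ u v → f u v ≡ g u v) → ΣF² f ≡ ΣF² g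
ΣF²-cong f≗g = ΣF-cong (λ u → ΣF-cong (f≗g u))

ΣF²-+ : ∀ {n} (f g : Fin n → Fin n → ℚ) → ΣF² (λ u v → f u v + g u v) ≡ ΣF² f + ΣF² g
ΣF²-+ f g = trans (ΣF-cong (λ u → ΣF-+ (f u) (g u))) (ΣF-+ (λ u → ΣF (f u)) (λ u → ΣF (g u)))

ΣF²-product : ∀ {n} (f g : Fin n → ℚ) → ΣF² (λ u v → f u * g v) ≡ ΣF f * ΣF g
ΣF²-product f g = trans (ΣF-cong (λ u → ΣF-*ˡ (f u) g)) (ΣF-*ʳ (ΣF g) f)

ΣF²-*-ΣF : ∀ {n k} (c : Fin n → Fin n → ℚ) (g : Fin k → Fin n → Fin n → ℚ) →
           ΣF² (λ u v → c u v * ΣF (λ i → g i u v)) ≡ ΣF (λ i → ΣF² (λ u v → c u v * g i u v))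
ΣF²-*-ΣF c g = begin
  ΣF² (λ u v → c u v * ΣF (λ i → g i u v))
    ≡⟨ ΣF²-cong (λ u v → sym (ΣF-*ˡ (c u v) (λ i → g i u v))) ⟩
  ΣF (λ u → ΣF (λ v → ΣF (λ i → c u v * g i u v)))
    ≡⟨ ΣF-cong (λ u → ΣF-swap (λ v i → c u v * g i u v)) ⟩
  ΣF (λ u → ΣF (λ i → ΣF (λ v → c u v * g i u v)))
    ≡⟨ ΣF-swap (λ u i → ΣF (λ v → c u v * g i u v)) ⟩
  ΣF (λ i → ΣF² (λ u v → c u v * g i u v)) ∎
  where open ≡-Reasoning

before : ∀ {n} → Fin n → Fin n → Bool
before u v = ⌊ toℕ u ℕ.<? toℕ v ⌋

if-+ : ∀ b (x y : ℚ) → (if b then x + y else 0ℚ) ≡ (if b then x else 0ℚ) + (if b then y else 0ℚ)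
if-+ true  x y = refl
if-+ false x y = sym (+-identityʳ 0ℚ)

before-split : ∀ {n} (u v : Fin n) (x : ℚ) → (u ≡ v → x ≡ 0ℚ) →
               (if before u v then x else 0ℚ) + (if before v u then x else 0ℚ) ≡ x
before-split u v x diag with toℕ u ℕ.<? toℕ v | toℕ v ℕ.<? toℕ u
... | yes u<v | yes v<u = ⊥-elim (ℕ.<-asym u<v v<u)
... | yes _   | no _    = +-identityʳ x
... | no _    | yes _   = +-identityˡ x
... | no u≮v  | no v≮u  = trans (+-identityʳ 0ℚ)
  (sym (diag (Fin.toℕ-injective (ℕ.≤-antisym (ℕ.≮⇒≥ v≮u) (ℕ.≮⇒≥ u≮v)))))

ΣF²-unorderedPairs : ∀ {n} (f : Fin n → Fin n → ℚ) → (∀ u → f u u ≡ 0ℚ) →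
  ΣF² (λ u v → if before u v then f u v + f v u else 0ℚ) ≡ ΣF² f
ΣF²-unorderedPairs {n} f f-diag = begin
  ΣF² (λ u v → if before u v then f u v + f v u else 0ℚ)
    ≡⟨ ΣF²-cong (λ u v → if-+ (before u v) (f u v) (f v u)) ⟩
  ΣF² (λ u v → P u v + Q v u)   ≡⟨ ΣF²-+ P (λ u v → Q v u) ⟩
  ΣF² P + ΣF² (λ u v → Q v u)   ≡⟨ cong (ΣF² P +_) (ΣF-swap (λ u v → Q v u)) ⟩
  ΣF² P + ΣF² Q                 ≡⟨ sym (ΣF²-+ P Q) ⟩
  ΣF² (λ u v → P u v + Q u v)   ≡⟨ ΣF²-cong (λ u v → before-split u v (f u v) (diag u v)) ⟩
  ΣF² f                         ∎
  where
  open ≡-Reasoning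
  P Q : Fin n → Fin n → ℚ
  P u v = if before u v then f u v else 0ℚ
  Q u v = if before v u then f u v else 0ℚ
  diag : ∀ u v → u ≡ v → f u v ≡ 0ℚ
  diag u .u refl = f-diag u

W-orderedPairs : ∀ {n} (d : Fin n → Fin n → ℕ) (a b : Fin n → ℚ) →
  (∀ u v → d u v ≡ d v u) → (∀ u → d u u ≡ 0) →
  W d a b ≡ ΣF² (λ u v → a u * b v * ℕ→ℚ (d u v))
W-orderedPairs {n} d a b d-sym d-diag =
  trans (ΣF²-cong (λ u v → cong (if before u v then_else 0ℚ) (expand u v)))
        (ΣF²-unorderedPairs f (λ u → trans (cong (λ k → a u * b u * ℕ→ℚ k) (d-diag u)) (*-zeroʳ (a u * b u))))
  where
  f : Fin n → Fin n → ℚ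
  f u v = a u * b v * ℕ→ℚ (d u v)
  expand : ∀ u v → (a u * b v + a v * b u) * ℕ→ℚ (d u v) ≡ f u v + f v u
  expand u v = trans (*-distribʳ-+ _ (a u * b v) _) (cong (λ k → f u v + a v * b u * ℕ→ℚ k) (d-sym u v))

differ : Bool → Bool → ℚ
differ true  false = 1ℚ
differ false true  = 1ℚ
differ _     _     = 0ℚ

differ-refl : ∀ s → differ s s ≡ 0ℚ
differ-refl true  = refl
differ-refl false = refl

differ-≢ : ∀ {s t} → s ≢ t → differ s t ≡ 1ℚ
differ-≢ {true}  {true}  s≢t = ⊥-elim (s≢t refl)
differ-≢ {true}  {false} s≢t = refl
differ-≢ {false} {true}  s≢t = refl
differ-≢ {false} {false} s≢t = ⊥-elim (s≢t refl)

restrict : Bool → Bool → ℚ → ℚ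
restrict s t x = if ⌊ s Bool.≟ t ⌋ then x else 0ℚ

*-differ : ∀ s t (x y : ℚ) →
  x * y * differ s t ≡ restrict s true x * restrict t false y + restrict s false x * restrict t true y
*-differ true  true  x y = solve 2 (λ x y → x :* y :* con 0ℚ := x :* con 0ℚ :+ con 0ℚ :* y) refl x y
*-differ true  false x y = solve 2 (λ x y → x :* y :* con 1ℚ := x :* y :+ con 0ℚ :* con 0ℚ) refl x y
*-differ false true  x y = solve 2 (λ x y → x :* y :* con 1ℚ := con 0ℚ :* con 0ℚ :+ x :* y) refl x y
*-differ false false x y = solve 2 (λ x y → x :* y :* con 0ℚ := con 0ℚ :* y :+ x :* con 0ℚ) refl x y

ΣF²-differ : ∀ {n} (a b : Fin n → ℚ) (side : Fin n → Bool) →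
  ΣF² (λ u v → a u * b v * differ (side u) (side v)) ≡
  ΣSide side true a * ΣSide side false b + ΣSide side false a * ΣSide side true b
ΣF²-differ {n} a b side = begin
  ΣF² (λ u v → a u * b v * differ (side u) (side v))
    ≡⟨ ΣF²-cong (λ u v → *-differ (side u) (side v) (a u) (b v)) ⟩
  ΣF² (λ u v → onSide true a u * onSide false b v + onSide false a u * onSide true b v)
    ≡⟨ ΣF²-+ (λ u v → onSide true a u * onSide false b v) (λ u v → onSide false a u * onSide true b v) ⟩
  ΣF² (λ u v → onSide true a u * onSide false b v) + ΣF² (λ u v → onSide false a u * onSide true b v)
    ≡⟨ cong₂ _+_ (ΣF²-product (onSide true a) (onSide false b)) (ΣF²-product (onSide false a) (onSide true b)) ⟩
  ΣSide side true a * ΣSide side false b + ΣSide side false a * ΣSide side true b ∎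
  where
  open ≡-Reasoning
  onSide : Bool → (Fin n → ℚ) → Fin n → ℚ
  onSide t w x = restrict (side x) t (w x)

ℕ→ℚ-suc : ∀ m → ℕ→ℚ (suc m) ≡ 1ℚ + ℕ→ℚ m
ℕ→ℚ-suc m = begin
  ℕ→ℚ (suc m)
    ≡⟨ cong (λ i → (ℤ.+ 1 ℤ.+ i) / 1) (sym (ℤ.*-identityʳ (ℤ.+ m))) ⟩
  1ℚ + mkℚ (ℤ.+ m) 0 1-coprime-m
    ≡⟨ cong (1ℚ +_) (sym (normalize-coprime 1-coprime-m)) ⟩
  1ℚ + ℕ→ℚ m ∎
  where
  open ≡-Reasoning
  1-coprime-m : Coprime.Coprime m 1
  1-coprime-m = Coprime.sym (Coprime.1-coprimeTo m)

module Walks {n} (G : Graph n) where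

  walk₀⇒≡ : ∀ {A u v} → Walk G A u v 0 → u ≡ v
  walk₀⇒≡ nil = refl

  _++ʷ_ : ∀ {A u w v i j} → Walk G A u w i → Walk G A w v j → Walk G A u v (i ℕ.+ j)
  nil          ++ʷ ω′ = ω′
  cons p ok ω ++ʷ ω′ = cons p ok (ω ++ʷ ω′)

  snoc : ∀ {A u w v m} → Walk G A u w m → (p : Adj G w v) → A w v p → Walk G A u v (suc m)
  snoc nil          p ok = cons p ok nil
  snoc (cons q a ω) p ok = cons q a (snoc ω p ok)

  reverse : ∀ {u v m} → Walk G (AllEdges G) u v m → Walk G (AllEdges G) v u m
  reverse nil           = nil
  reverse (cons p tt ω) = snoc (reverse ω) (Graph.sym G p) tt

module Distance {n} (G : Graph n) (d : Fin n → Fin n → ℕ) (isD : IsDistance G d) where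
  open Walks G

  geodesic : ∀ u v → Walk G (AllEdges G) u v (d u v)
  geodesic = proj₁ isD

  d-minimal : ∀ {u v m} → Walk G (AllEdges G) u v m → d u v ≤ m
  d-minimal ω = proj₂ isD _ _ _ ω

  d-sym : ∀ u v → d u v ≡ d v u
  d-sym u v = ℕ.≤-antisym (d-minimal (reverse (geodesic v u))) (d-minimal (reverse (geodesic u v)))

  d-diag : ∀ u → d u u ≡ 0
  d-diag u = ℕ.n≤0⇒n≡0 (d-minimal nil)

  d-adj : ∀ {x y} → Adj G x y → d x y ≡ 1
  d-adj {x} {y} p = ℕ.≤-antisym (d-minimal (cons p tt nil)) (ℕ.n≢0⇒n>0 d≢0)
    where
    d≢0 : d x y ≢ 0
    d≢0 d≡0 = irrefl G (subst (λ z → Adj G z y) x≡y p)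
      where
      x≡y : x ≡ y
      x≡y = walk₀⇒≡ (subst (Walk G (AllEdges G) x y) d≡0 (geodesic x y))

  d-adj-step : ∀ s {x y} → Adj G x y → d s y ≤ suc (d s x)
  d-adj-step s {x} {y} p = subst (d s y ≤_) (ℕ.+-comm (d s x) 1)
    (subst (λ e → d s y ≤ d s x ℕ.+ e) (d-adj p) (d-minimal (geodesic s x ++ʷ geodesic x y)))

  geodesic-tail : ∀ {u u′ v m} → Adj G u u′ → Walk G (AllEdges G) u′ v m → d u v ≡ suc m → d u′ v ≡ m
  geodesic-tail {u} {u′} {v} p ω e = ℕ.≤-antisym (d-minimal ω)
    (ℕ.s≤s⁻¹ (subst (_≤ suc (d u′ v)) e (d-minimal (cons p tt (geodesic u′ v)))))

  geodesic-step : ∀ s {x y v m} → Adj G x y → Walk G (AllEdges G) y v m →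
                  d s x ℕ.+ suc m ≡ d s v → d s y ≡ suc (d s x) × d s y ℕ.+ m ≡ d s v
  geodesic-step s {x} {y} {v} {m} p ω e =
    ℕ.+-cancelʳ-≡ m _ _ (trans via-y (trans (sym e) (ℕ.+-suc (d s x) m))) , via-y
    where
    via-y : d s y ℕ.+ m ≡ d s v
    via-y = ℕ.≤-antisym
      (subst (d s y ℕ.+ m ≤_) (trans (sym (ℕ.+-suc (d s x) m)) e) (ℕ.+-monoˡ-≤ m (d-adj-step s p)))
      (d-minimal (geodesic s y ++ʷ ω))

module ThetaClasses {n} (G : Graph n) (d : Fin n → Fin n → ℕ) (isD : IsDistance G d)
  {k} (cls : (u v : Fin n) → Adj G u v → Fin k)
  (cls⇔Θ : ∀ u₁ v₁ u₂ v₂ (p : Adj G u₁ v₁) (q : Adj G u₂ v₂) →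
           (cls u₁ v₁ p ≡ cls u₂ v₂ q) ⇔ Θ d u₁ v₁ u₂ v₂) where
  open Distance G d isD

  AvoidClass : Fin k → (x y : Fin n) → Adj G x y → Set
  AvoidClass i x y q = cls x y q ≢ i

  module _ {u u′ : Fin n} (p : Adj G u u′) where

    balanced⇒avoid : ∀ {x y} (q : Adj G x y) →
                     d x u ℕ.+ d y u′ ≡ d x u′ ℕ.+ d y u → AvoidClass (cls u u′ p) x y q
    balanced⇒avoid {x} {y} q balanced same = Equivalence.to (cls⇔Θ x y u u′ q p) same balanced

    avoid⇒balanced : ∀ {x y} (q : Adj G x y) →
                     AvoidClass (cls u u′ p) x y q → d x u ℕ.+ d y u′ ≡ d x u′ ℕ.+ d y u
    avoid⇒balanced {x} {y} q avoid = decidable-stable (_ ℕ.≟ _)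
      (λ θ → avoid (Equivalence.from (cls⇔Θ x y u u′ q p) θ))

    geodesic-avoids : ∀ {x v m} → Walk G (AllEdges G) x v m →
                      d u x ℕ.+ m ≡ d u v → d u′ x ℕ.+ m ≡ d u′ v → Walk G (AvoidClass (cls u u′ p)) x v m
    geodesic-avoids nil _ _ = nil
    geodesic-avoids {x} {v} (cons {w = y} {k = m} q tt ω) from-u from-u′ =
      cons q (balanced⇒avoid q balanced) (geodesic-avoids ω (proj₂ u-step) (proj₂ u′-step))
      where
      u-step : d u y ≡ suc (d u x) × d u y ℕ.+ m ≡ d u v
      u-step = geodesic-step u q ω from-u
      u′-step : d u′ y ≡ suc (d u′ x) × d u′ y ℕ.+ m ≡ d u′ v
      u′-step = geodesic-step u′ q ω from-u′
      balanced : d x u ℕ.+ d y u′ ≡ d x u′ ℕ.+ d y u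
      balanced = begin
        d x u ℕ.+ d y u′         ≡⟨ cong₂ ℕ._+_ (d-sym x u) (trans (d-sym y u′) (proj₁ u′-step)) ⟩
        d u x ℕ.+ suc (d u′ x)   ≡⟨ ℕ.+-comm (d u x) (suc (d u′ x)) ⟩
        suc (d u′ x ℕ.+ d u x)   ≡⟨ sym (ℕ.+-suc (d u′ x) (d u x)) ⟩
        d u′ x ℕ.+ suc (d u x)   ≡⟨ cong₂ ℕ._+_ (d-sym u′ x) (sym (trans (d-sym y u) (proj₁ u-step))) ⟩
        d x u′ ℕ.+ d y u         ∎
        where open ≡-Reasoning

    avoiding-walk-keeps-side : ∀ {w z m} → Walk G (AvoidClass (cls u u′ p)) w z m →
                               d w u′ ≡ suc (d w u) → d z u′ ≡ suc (d z u)
    avoiding-walk-keeps-side nil near = near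
    avoiding-walk-keeps-side {w} (cons {w = y} q avoid ω) near =
      avoiding-walk-keeps-side ω (ℕ.+-cancelˡ-≡ (d w u) _ _ (begin
        d w u ℕ.+ d y u′        ≡⟨ avoid⇒balanced q avoid ⟩
        d w u′ ℕ.+ d y u        ≡⟨ cong (ℕ._+ d y u) near ⟩
        suc (d w u ℕ.+ d y u)   ≡⟨ sym (ℕ.+-suc (d w u) (d y u)) ⟩
        d w u ℕ.+ suc (d y u)   ∎))
      where open ≡-Reasoning

  module _ (side : Fin k → Fin n → Bool)
    (side⇔connected : ∀ i u v → (side i u ≡ side i v) ⇔ Connected G (AvoidClass i) u v) where

    edge-keeps-other-sides : ∀ {u u′} (p : Adj G u u′) {i} → i ≢ cls u u′ p → side i u ≡ side i u′
    edge-keeps-other-sides {u} {u′} p {i} i≢ =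
      Equivalence.from (side⇔connected i u u′) (1 , cons p (λ same → i≢ (sym same)) nil)

    geodesic-tail-same-side : ∀ {u u′ v m} (p : Adj G u u′) → Walk G (AllEdges G) u′ v m →
                              d u v ≡ suc m → side (cls u u′ p) u′ ≡ side (cls u u′ p) v
    geodesic-tail-same-side {u} {u′} {v} {m} p ω e =
      Equivalence.from (side⇔connected _ u′ v) (m , geodesic-avoids p ω from-u from-u′)
      where
      from-u : d u u′ ℕ.+ m ≡ d u v
      from-u = trans (cong (ℕ._+ m) (d-adj p)) (sym e)
      from-u′ : d u′ u′ ℕ.+ m ≡ d u′ v
      from-u′ = trans (cong (ℕ._+ m) (d-diag u′)) (sym (geodesic-tail p ω e))

    edge-separates : ∀ {u u′ v} (p : Adj G u u′) → d u v ≡ suc (d u′ v) →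
                     side (cls u u′ p) u ≢ side (cls u u′ p) v
    edge-separates {u} {u′} {v} p e same with Equivalence.to (side⇔connected _ u v) same
    ... | _ , ω = ℕ.m≢1+n+m (d u′ v) (begin
      d u′ v          ≡⟨ d-sym u′ v ⟩
      d v u′          ≡⟨ avoiding-walk-keeps-side p ω (trans (d-adj p) (cong suc (sym (d-diag u)))) ⟩
      suc (d v u)     ≡⟨ cong suc (trans (d-sym v u) e) ⟩
      2 ℕ.+ d u′ v    ∎)
      where open ≡-Reasoning

    distance≡separatingClasses : ∀ u v → ℕ→ℚ (d u v) ≡ ΣF (λ i → differ (side i u) (side i v))
    distance≡separatingClasses u v = along (geodesic u v) refl
      where
      along : ∀ {u m} → Walk G (AllEdges G) u v m → d u v ≡ m →
              ℕ→ℚ m ≡ ΣF (λ i → differ (side i u) (side i v))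
      along nil _ = sym (ΣF-zero (λ i → differ-refl (side i v)))
      along {u} (cons {w = u′} {k = m} p tt ω) e = begin
        ℕ→ℚ (suc m)                                    ≡⟨ ℕ→ℚ-suc m ⟩
        1ℚ + ℕ→ℚ m                                     ≡⟨ cong (1ℚ +_) (along ω tail) ⟩
        1ℚ + ΣF (λ i → differ (side i u′) (side i v))  ≡⟨ sym (ΣF-differAt i₀ 1ℚ others first) ⟩
        ΣF (λ i → differ (side i u) (side i v))        ∎
        where
        open ≡-Reasoning
        tail : d u′ v ≡ m
        tail = geodesic-tail p ω e
        i₀ : Fin k
        i₀ = cls u u′ p
        others : ∀ i → i ≢ i₀ → differ (side i u) (side i v) ≡ differ (side i u′) (side i v)
        others i i≢ = cong (λ s → differ s (side i v)) (edge-keeps-other-sides p i≢)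
        first : differ (side i₀ u) (side i₀ v) ≡ 1ℚ + differ (side i₀ u′) (side i₀ v)
        first = begin
          differ (side i₀ u) (side i₀ v)
            ≡⟨ differ-≢ (edge-separates p (trans e (cong suc (sym tail)))) ⟩
          1ℚ                                    ≡⟨ sym (+-identityʳ 1ℚ) ⟩
          1ℚ + 0ℚ                               ≡⟨ cong (1ℚ +_) (sym (differ-refl (side i₀ v))) ⟩
          1ℚ + differ (side i₀ v) (side i₀ v)
            ≡⟨ cong (λ s → 1ℚ + differ s (side i₀ v)) (sym (geodesic-tail-same-side p ω e)) ⟩
          1ℚ + differ (side i₀ u′) (side i₀ v)  ∎

mainTheorem4 :
    ∀ {n} (G : Graph n) (d : Fin n → Fin n → ℕ) →
    IsDistance G d → IsPartialCube G d →
    (a b : Fin n → ℚ) → (∀ x → 0ℚ < a x) → (∀ x → 0ℚ < b x) →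
    -- the Θ-classes E_1 … E_k, given by a labelling of edges
    (k : ℕ) (cls : (u v : Fin n) → Adj G u v → Fin k) →
    (∀ i → ∃[ u ] ∃[ v ] Σ (Adj G u v) λ p → cls u v p ≡ i) →
    (∀ u₁ v₁ u₂ v₂ (p : Adj G u₁ v₁) (q : Adj G u₂ v₂) →
       (cls u₁ v₁ p ≡ cls u₂ v₂ q) ⇔ Θ d u₁ v₁ u₂ v₂) →
    -- side i describes the two connected components of G ∖ E_i
    (side : Fin k → Fin n → Bool) →
    (∀ i u v → (side i u ≡ side i v) ⇔
       Connected G (λ x y p → cls x y p ≢ i) u v) →
    (∀ i → (∃[ u ] side i u ≡ true) × (∃[ v ] side i v ≡ false)) →
    W d a b ≡ ΣF (λ i →
       ΣSide (side i) true a * ΣSide (side i) false b +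
       ΣSide (side i) false a * ΣSide (side i) true b)
mainTheorem4 G d isD _ a b _ _ k cls _ cls⇔Θ side side⇔connected _ = begin
  W d a b
    ≡⟨ W-orderedPairs d a b d-sym d-diag ⟩
  ΣF² (λ u v → a u * b v * ℕ→ℚ (d u v))
    ≡⟨ ΣF²-cong (λ u v → cong (a u * b v *_) (distance≡separatingClasses side side⇔connected u v)) ⟩
  ΣF² (λ u v → a u * b v * ΣF (λ i → differ (side i u) (side i v)))
    ≡⟨ ΣF²-*-ΣF (λ u v → a u * b v) (λ i u v → differ (side i u) (side i v)) ⟩
  ΣF (λ i → ΣF² (λ u v → a u * b v * differ (side i u) (side i v)))
    ≡⟨ ΣF-cong (λ i → ΣF²-differ a b (side i)) ⟩
  ΣF (λ i → ΣSide (side i) true a * ΣSide (side i) false b + ΣSide (side i) false a * ΣSide (side i) true b) ∎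
  where
  open ≡-Reasoning
  open Distance G d isD
  open ThetaClasses G d isD cls cls⇔Θ
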